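{- Let $\eta(r)$ denote the maximum number of vertices of a $(2,3)$-agreeable graph with clique number at most $r$. Then $\eta(1)=2$, $\eta(2)=5$, $\eta(3)=8$, $\eta(4)=13$, and $\eta(5)\leq 18$.
   Context: A simple undirected graph is $(2,3)$-agreeable if any three of its vertices induce a subgraph containing at least one edge. -}

module Defs where

open import Data.Nat using (ℕ; suc; _≤_)
open import Data.Fin using (Fin)
open import Data.Bool using (Bool; true; false)
open import Data.Product using (Σ; _×_)
open import Data.Sum using (_⊎_)
open import Relation.Binary.PropositionalEquality using (_≡_; _≢_)
open import Relation.Nullary using (¬_)
open import Function.Definitions using (Injective)

record Graph (n : ℕ) : Set where
  field
    Adj    : Fin n → Fin n → Bool
    sym    : ∀ i j → Adj i j ≡ Adj j i
    irrefl : ∀ i → Adj i i ≡ false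
open Graph public

Agreeable : ∀ {n} → Graph n → Set
Agreeable {n} G =
  (x y z : Fin n) → x ≢ y → y ≢ z → x ≢ z →
  (Adj G x y ≡ true) ⊎ (Adj G y z ≡ true) ⊎ (Adj G x z ≡ true)

IsClique : ∀ {n k} → Graph n → (Fin k → Fin n) → Set
IsClique {n} {k} G f =
  Injective _≡_ _≡_ f × (∀ i j → i ≢ j → Adj G (f i) (f j) ≡ true)

CliqueNumber≤ : ∀ {n} → Graph n → ℕ → Set
CliqueNumber≤ {n} G r = (f : Fin (suc r) → Fin n) → ¬ IsClique G f

Admissible : ℕ → ℕ → Set
Admissible r n = Σ (Graph n) λ G → Agreeable G × CliqueNumber≤ G r

η≡ : ℕ → ℕ → Set
η≡ r m = Admissible r m × (∀ n → Admissible r n → n ≤ m)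

η≤ : ℕ → ℕ → Set
η≤ r m = ∀ n → Admissible r n → n ≤ m

-- Fix a vertex v of an agreeable graph. Any two non-neighbours of v span an edge, since together
-- with v they induce one, so the non-neighbours form a clique; if the clique number is at most
-- r + 1, the neighbours induce an agreeable graph of clique number at most r, since v extends
-- each of their cliques. Hence
-- η(r+1) ≤ η(r) + (r+1) + 1, which from η(0) = 0 gives 2, 5, 9, 13, 19. If this bound is attained,
-- every vertex has degree exactly η(r), so by the handshake lemma (η(r) + r + 2) · η(r) is even;
-- as 9 · 5 and 19 · 13 are odd, this improves the bounds to η(3) ≤ 8 and η(5) ≤ 18.
-- The matching lower bounds are circulant graphs, checked by exhaustive computation.
module Submission where

open import Defs hiding (sym)
open import Data.Bool using (Bool; true; false; _∧_; T)
open import Data.Bool.Properties using (T-∧; T-≡)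
open import Data.Empty using (⊥; ⊥-elim)
open import Data.Fin using (Fin; zero; suc; toℕ; inject≤)
open import Data.Fin.Properties using (all?; inject≤-injective; suc-injective) renaming (_≟_ to _≟ᶠ_)
open import Data.List using (List; []; _∷_; _++_; [_]; length; map; filter; allFin; lookup)
open import Data.List.Properties using (length-++; filter-++; length-tabulate)
open import Data.List.Membership.Propositional using (_∈_; _∉_)
open import Data.List.Membership.Propositional.Properties using (∈-filter⁻; ∈-∃++; ∈-lookup)
open import Data.List.Relation.Binary.Subset.Propositional using (_⊆_)
open import Data.List.Relation.Binary.Permutation.Propositional using (_↭_; ↭-sym; ↭⇒↭ₛ)
open import Data.List.Relation.Binary.Permutation.Propositional.Properties using (↭-length; ∈-resp-↭; filter-↭; shift)
import Data.List.Relation.Binary.Permutation.Setoid.Properties as Permutationₛ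
open import Data.List.Relation.Unary.Any using (here; there)
open import Data.List.Relation.Unary.All as All using (All; []; _∷_)
open import Data.List.Relation.Unary.All.Properties using (all-filter) renaming (filter⁺ to All-filter⁺)
open import Data.List.Relation.Unary.AllPairs as AllPairs using (AllPairs; []; _∷_)
open import Data.List.Relation.Unary.Unique.Propositional using (Unique)
open import Data.List.Relation.Unary.Unique.Propositional.Properties using (allFin⁺) renaming (filter⁺ to Unique-filter⁺)
open import Data.Nat using (ℕ; zero; suc; _+_; _*_; _≤_; z≤n; s≤s; s≤s⁻¹; ∣_-_∣)
import Data.Nat
import Data.Nat.Properties
open import Data.List.Membership.DecPropositional Data.Nat._≟_ using (_∈?_)
open import Data.Nat.Divisibility using (_∣_; _∣?_; ∣m∣n⇒∣m+n; m∣m*n; n∣m*n)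
open import Data.Nat.ListAction using (sum)
open import Data.Nat.Properties
  using (+-suc; +-assoc; +-identityʳ; +-mono-≤; +-monoʳ-≤; +-cancelʳ-≤; ≤-antisym; ≰⇒>; m≤n⇒m<n∨m≡n; ∣-∣-comm; ∣n-n∣≡0; +-commutativeSemigroup; module ≤-Reasoning)
open import Algebra.Properties.CommutativeSemigroup +-commutativeSemigroup using () renaming (interchange to +-interchange)
open import Data.Product using (Σ; _×_; _,_; proj₁; proj₂)
open import Data.Sum using (inj₁; inj₂)
open import Function using (_∘_; Equivalence)
open import Relation.Binary using (Rel; Symmetric)
open import Relation.Binary.PropositionalEquality using (_≡_; _≢_; refl; sym; trans; cong; cong₂; subst; setoid; module ≡-Reasoning)
open import Relation.Nullary using (¬_; Dec; yes; no; does)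
open import Relation.Nullary.Decidable using (True; toWitness; from-no; dec-false; ¬?; _⊎-dec_; _→-dec_; T?)
open import Relation.Unary using (Pred; Decidable)
open import Relation.Unary.Properties using (∁?)

module _ {a} {A : Set a} where

  length-filter-∁ : ∀ {p} {P : Pred A p} (P? : Decidable P) xs →
                    length (filter P? xs) + length (filter (∁? P?) xs) ≡ length xs
  length-filter-∁ P? [] = refl
  length-filter-∁ P? (x ∷ xs) with does (P? x)
  ... | true  = cong suc (length-filter-∁ P? xs)
  ... | false = trans (+-suc _ _) (cong suc (length-filter-∁ P? xs))

  AllPairs-mapOn : ∀ {p r s} {P : Pred A p} {R : Rel A r} {S : Rel A s} →
                   (∀ {x y} → P x → P y → R x y → S x y) →
                   ∀ {xs} → All P xs → AllPairs R xs → AllPairs S xs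
  AllPairs-mapOn f [] [] = []
  AllPairs-mapOn f (px ∷ pxs) (rx ∷ rxs) =
    All.zipWith (λ (py , rxy) → f px py rxy) (pxs , rx) ∷ AllPairs-mapOn f pxs rxs

  AllPairs-lookup : ∀ {r} {R : Rel A r} → Symmetric R → ∀ {xs} → AllPairs R xs →
                    ∀ {i j} → i ≢ j → R (lookup xs i) (lookup xs j)
  AllPairs-lookup sym (rx ∷ rxs) {zero}  {zero}  i≢j = ⊥-elim (i≢j refl)
  AllPairs-lookup sym (rx ∷ rxs) {zero}  {suc j} _   = All.lookup rx (∈-lookup j)
  AllPairs-lookup sym (rx ∷ rxs) {suc i} {zero}  _   = sym (All.lookup rx (∈-lookup i))
  AllPairs-lookup sym (rx ∷ rxs) {suc i} {suc j} i≢j = AllPairs-lookup sym rxs (i≢j ∘ cong suc)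

  ∈⇒↭∷ : ∀ {x xs} → x ∈ xs → Σ (List A) λ ys → xs ↭ x ∷ ys
  ∈⇒↭∷ x∈xs with ys , zs , refl ← ∈-∃++ x∈xs = ys ++ zs , shift _ ys zs

  Unique-resp-↭ : ∀ {xs ys} → xs ↭ ys → Unique xs → Unique ys
  Unique-resp-↭ p = Permutationₛ.Unique-resp-↭ (setoid A) (↭⇒↭ₛ p)

  sum-map-const : ∀ (f : A → ℕ) {b xs} → All (λ x → f x ≡ b) xs → sum (map f xs) ≡ length xs * b
  sum-map-const f [] = refl
  sum-map-const f (fx≡b ∷ fxs≡b) = cong₂ _+_ fx≡b (sum-map-const f fxs≡b)

module Neighbourhoods {n} (G : Graph n) where

  infix 4 _~_ _~?_

  _~_ : Fin n → Fin n → Set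
  x ~ y = Adj G x y ≡ true

  _~?_ : ∀ x y → Dec (x ~ y)
  x ~? y = Adj G x y Data.Bool.≟ true

  ~-sym : Symmetric _~_
  ~-sym {x} {y} x~y = trans (Graph.sym G y x) x~y

  ~-irrefl : ∀ {x} → ¬ x ~ x
  ~-irrefl {x} x~x with () ← trans (sym (irrefl G x)) x~x

  neighbours nonNeighbours : Fin n → List (Fin n) → List (Fin n)
  neighbours    v = filter (v ~?_)
  nonNeighbours v = filter (∁? (v ~?_))

  ∈-neighbours⁻ : ∀ {v x} L → x ∈ neighbours v L → x ∈ L × v ~ x
  ∈-neighbours⁻ {v} L = ∈-filter⁻ (v ~?_) {xs = L}

  ∈-nonNeighbours⁻ : ∀ {v x} L → x ∈ nonNeighbours v L → x ∈ L × ¬ v ~ x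
  ∈-nonNeighbours⁻ {v} L = ∈-filter⁻ (∁? (v ~?_)) {xs = L}

  degree : Fin n → List (Fin n) → ℕ
  degree v L = length (neighbours v L)

  degree-++ : ∀ v xs ys → degree v (xs ++ ys) ≡ degree v xs + degree v ys
  degree-++ v xs ys = trans (cong length (filter-++ (v ~?_) xs ys)) (length-++ (neighbours v xs))

  degree-self : ∀ v L → degree v (v ∷ L) ≡ degree v L
  degree-self v L rewrite irrefl G v = refl

  degree-singleton-sym : ∀ u v → degree u [ v ] ≡ degree v [ u ]
  degree-singleton-sym u v rewrite Graph.sym G u v with Adj G v u
  ... | true  = refl
  ... | false = refl

  degreeSum : List (Fin n) → List (Fin n) → ℕ
  degreeSum L′ L = sum (map (λ v → degree v L′) L)

  degreeSum-∷ˡ : ∀ x L′ L → degreeSum (x ∷ L′) L ≡ degree x L + degreeSum L′ L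
  degreeSum-∷ˡ x L′ [] = refl
  degreeSum-∷ˡ x L′ (v ∷ L) = begin
    degree v (x ∷ L′) + degreeSum (x ∷ L′) L
      ≡⟨ cong₂ _+_ (degree-++ v [ x ] L′) (degreeSum-∷ˡ x L′ L) ⟩
    (degree v [ x ] + degree v L′) + (degree x L + degreeSum L′ L)
      ≡⟨ cong (λ d → (d + degree v L′) + (degree x L + degreeSum L′ L)) (degree-singleton-sym v x) ⟩
    (degree x [ v ] + degree v L′) + (degree x L + degreeSum L′ L)
      ≡⟨ +-interchange (degree x [ v ]) (degree v L′) (degree x L) (degreeSum L′ L) ⟩
    (degree x [ v ] + degree x L) + (degree v L′ + degreeSum L′ L)
      ≡⟨ cong (_+ (degree v L′ + degreeSum L′ L)) (sym (degree-++ x [ v ] L)) ⟩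
    degree x (v ∷ L) + degreeSum L′ (v ∷ L) ∎
    where open ≡-Reasoning

  handshake : ∀ L → 2 ∣ degreeSum L L
  handshake [] = n∣m*n 0
  handshake (x ∷ L) = subst (2 ∣_) (sym degreeSum≡) (∣m∣n⇒∣m+n (m∣m*n (degree x L)) (handshake L))
    where
    open ≡-Reasoning
    d = degree x L
    degreeSum≡ : degreeSum (x ∷ L) (x ∷ L) ≡ 2 * d + degreeSum L L
    degreeSum≡ = begin
      degree x (x ∷ L) + degreeSum (x ∷ L) L ≡⟨ cong₂ _+_ (degree-self x L) (degreeSum-∷ˡ x L L) ⟩
      d + (d + degreeSum L L)               ≡⟨ sym (+-assoc d d _) ⟩
      d + d + degreeSum L L                 ≡⟨ cong (λ e → d + e + degreeSum L L) (sym (+-identityʳ d)) ⟩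
      2 * d + degreeSum L L                 ∎

  Clique : List (Fin n) → Set
  Clique = AllPairs _~_

  clique-length≤ : ∀ {r} → CliqueNumber≤ G r → ∀ {K} → Clique K → length K ≤ r
  clique-length≤ {r} ω≤r {K} clique with length K Data.Nat.≤? r
  ... | yes short = short
  ... | no long   = ⊥-elim (ω≤r f (f-injective , f-adjacent))
    where
    r<|K| : suc r ≤ length K
    r<|K| = ≰⇒> long
    f : Fin (suc r) → Fin n
    f i = lookup K (inject≤ i r<|K|)
    f-adjacent : ∀ i j → i ≢ j → f i ~ f j
    f-adjacent i j i≢j = AllPairs-lookup ~-sym clique (i≢j ∘ inject≤-injective _ _ i j)
    f-injective : ∀ {i j} → f i ≡ f j → i ≡ j
    f-injective {i} {j} fi≡fj with i ≟ᶠ j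
    ... | yes i≡j = i≡j
    ... | no  i≢j = ⊥-elim (~-irrefl (subst (_~ f j) fi≡fj (f-adjacent i j i≢j)))

  CliqueBounded : ℕ → List (Fin n) → Set
  CliqueBounded r L = ∀ {K} → Clique K → K ⊆ L → length K ≤ r

module SizeBounds {n} (G : Graph n) (agreeable : Agreeable G) where
  open Neighbourhoods G

  SizeBound : ℕ → ℕ → Set
  SizeBound r b = ∀ L → Unique L → CliqueBounded r L → length L ≤ b

  sizeBound-zero : SizeBound 0 0
  sizeBound-zero []      _ _       = z≤n
  sizeBound-zero (v ∷ L) _ bounded with () ← bounded ([] ∷ []) (λ { (here refl) → here refl })

  module _ {r b} (bound : SizeBound r b) {v L} (unique : Unique (v ∷ L))
           (bounded : CliqueBounded (suc r) (v ∷ L)) where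

    degree≤ : degree v L ≤ b
    degree≤ = bound (neighbours v L) (Unique-filter⁺ (v ~?_) (AllPairs.tail unique)) neighbours-bounded
      where
      neighbours-bounded : CliqueBounded r (neighbours v L)
      neighbours-bounded {K} clique K⊆N = s≤s⁻¹ (bounded (All.tabulate (proj₂ ∘ ∈-neighbours⁻ L ∘ K⊆N) ∷ clique) vK⊆vL)
        where
        vK⊆vL : v ∷ K ⊆ v ∷ L
        vK⊆vL (here refl) = here refl
        vK⊆vL (there k)   = there (proj₁ (∈-neighbours⁻ L (K⊆N k)))

    nonNeighbours-clique : Clique (nonNeighbours v L)
    nonNeighbours-clique = AllPairs-mapOn adjacent
      (All.zip (all-filter (∁? (v ~?_)) L , All-filter⁺ (∁? (v ~?_)) (AllPairs.head unique)))
      (Unique-filter⁺ (∁? (v ~?_)) (AllPairs.tail unique))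
      where
      adjacent : ∀ {x y} → ¬ v ~ x × v ≢ x → ¬ v ~ y × v ≢ y → x ≢ y → x ~ y
      adjacent (v≁x , v≢x) (v≁y , v≢y) x≢y with agreeable v _ _ v≢x x≢y v≢y
      ... | inj₁ v~x        = ⊥-elim (v≁x v~x)
      ... | inj₂ (inj₁ x~y) = x~y
      ... | inj₂ (inj₂ v~y) = ⊥-elim (v≁y v~y)

    nonNeighbours-length≤ : length (nonNeighbours v L) ≤ suc r
    nonNeighbours-length≤ = bounded nonNeighbours-clique (there ∘ proj₁ ∘ ∈-nonNeighbours⁻ L)

    length≤ : length L ≤ b + suc r
    length≤ = begin
      length L                                ≡⟨ sym (length-filter-∁ (v ~?_) L) ⟩
      degree v L + length (nonNeighbours v L) ≤⟨ +-mono-≤ degree≤ nonNeighbours-length≤ ⟩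
      b + suc r                               ∎
      where open ≤-Reasoning

    tight⇒degree≡ : length L ≡ b + suc r → degree v L ≡ b
    tight⇒degree≡ tight = ≤-antisym degree≤ (+-cancelʳ-≤ (suc r) b (degree v L) (begin
      b + suc r                               ≡⟨ sym tight ⟩
      length L                                ≡⟨ sym (length-filter-∁ (v ~?_) L) ⟩
      degree v L + length (nonNeighbours v L) ≤⟨ +-monoʳ-≤ (degree v L) nonNeighbours-length≤ ⟩
      degree v L + suc r                      ∎))
      where open ≤-Reasoning

  sizeBound-step : ∀ {r b} → SizeBound r b → SizeBound (suc r) (suc (b + suc r))
  sizeBound-step bound []      _      _       = z≤n
  sizeBound-step bound (v ∷ L) unique bounded = s≤s (length≤ bound unique bounded)

  tight⇒regular : ∀ {r b} → SizeBound r b → ∀ {L} → Unique L → CliqueBounded (suc r) L →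
                  length L ≡ suc (b + suc r) → All (λ v → degree v L ≡ b) L
  tight⇒regular {r} {b} bound {L} unique bounded tight = All.tabulate regular
    where
    regular : ∀ {v} → v ∈ L → degree v L ≡ b
    regular {v} v∈L with L′ , L↭vL′ ← ∈⇒↭∷ v∈L = begin
      degree v L        ≡⟨ ↭-length (filter-↭ (v ~?_) L↭vL′) ⟩
      degree v (v ∷ L′) ≡⟨ degree-self v L′ ⟩
      degree v L′       ≡⟨ tight⇒degree≡ bound (Unique-resp-↭ L↭vL′ unique) bounded′ tight′ ⟩
      b                 ∎
      where
      open ≡-Reasoning
      bounded′ : CliqueBounded (suc r) (v ∷ L′)
      bounded′ clique K⊆vL′ = bounded clique (∈-resp-↭ (↭-sym L↭vL′) ∘ K⊆vL′)
      tight′ : length L′ ≡ b + suc r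
      tight′ = Data.Nat.Properties.suc-injective (trans (sym (↭-length L↭vL′)) tight)

  sizeBound-parity : ∀ {r b} → SizeBound r b → ¬ 2 ∣ suc (b + suc r) * b → SizeBound (suc r) (b + suc r)
  sizeBound-parity {r} {b} bound odd L unique bounded with m≤n⇒m<n∨m≡n (sizeBound-step bound L unique bounded)
  ... | inj₁ (s≤s shorter) = shorter
  ... | inj₂ tight         = ⊥-elim (odd (subst (2 ∣_) degreeSum≡ (handshake L)))
    where
    degreeSum≡ : degreeSum L L ≡ suc (b + suc r) * b
    degreeSum≡ = trans (sum-map-const _ (tight⇒regular bound unique bounded tight)) (cong (_* b) tight)

  sizeBound₁ : SizeBound 1 2
  sizeBound₁ = sizeBound-step sizeBound-zero

  sizeBound₂ : SizeBound 2 5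
  sizeBound₂ = sizeBound-step sizeBound₁

  sizeBound₃ : SizeBound 3 8
  sizeBound₃ = sizeBound-parity sizeBound₂ (from-no (2 ∣? 9 * 5))

  sizeBound₄ : SizeBound 4 13
  sizeBound₄ = sizeBound-step sizeBound₃

  sizeBound₅ : SizeBound 5 18
  sizeBound₅ = sizeBound-parity sizeBound₄ (from-no (2 ∣? 19 * 13))

sizeBound⇒η≤ : ∀ {r b} →
               (∀ {n} (G : Graph n) (agreeable : Agreeable G) → SizeBounds.SizeBound G agreeable r b) →
               η≤ r b
sizeBound⇒η≤ bound n (G , agreeable , ω≤r) =
  subst (_≤ _) (length-tabulate (λ i → i))
    (bound G agreeable (allFin n) (allFin⁺ n) (λ clique _ → Neighbourhoods.clique-length≤ G ω≤r clique))

module CliqueSearch {n} (G : Graph n) where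
  open Neighbourhoods G

  CliqueFree : ℕ → (Fin n → Bool) → Set
  CliqueFree zero    C = ⊥
  CliqueFree (suc k) C = ∀ x → T (C x) → CliqueFree k (λ y → C y ∧ Adj G x y)

  cliqueFree? : ∀ k C → Dec (CliqueFree k C)
  cliqueFree? zero    C = no (λ ())
  cliqueFree? (suc k) C = all? λ x → T? (C x) →-dec cliqueFree? k (λ y → C y ∧ Adj G x y)

  cliqueFree⇒noClique : ∀ k C → CliqueFree k C → (f : Fin k → Fin n) →
                        (∀ i j → i ≢ j → f i ~ f j) → (∀ i → T (C (f i))) → ⊥
  cliqueFree⇒noClique (suc k) C free f adjacent inC =
    cliqueFree⇒noClique k _ (free (f zero) (inC zero)) (f ∘ suc)
      (λ i j i≢j → adjacent (suc i) (suc j) (i≢j ∘ suc-injective))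
      (λ i → Equivalence.from T-∧ (inC (suc i) , Equivalence.from T-≡ (adjacent zero (suc i) (λ ()))))

  cliqueNumber≤ : ∀ r → CliqueFree (suc r) (λ _ → true) → CliqueNumber≤ G r
  cliqueNumber≤ r free f (_ , adjacent) = cliqueFree⇒noClique (suc r) _ free f adjacent _

agreeable? : ∀ {n} (G : Graph n) → Dec (Agreeable G)
agreeable? G = all? λ x → all? λ y → all? λ z →
  ¬? (x ≟ᶠ y) →-dec ¬? (y ≟ᶠ z) →-dec ¬? (x ≟ᶠ z) →-dec
  (adjacent? x y ⊎-dec adjacent? y z ⊎-dec adjacent? x z)
  where open Neighbourhoods G renaming (_~?_ to adjacent?)

admissible : ∀ {r n} (G : Graph n) → True (agreeable? G) → True (CliqueSearch.cliqueFree? G (suc r) (λ _ → true)) →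
             Admissible r n
admissible {r} G agreeable free = G , toWitness agreeable , CliqueSearch.cliqueNumber≤ G r (toWitness free)

distanceGraph : ∀ n (S : List ℕ) → 0 ∉ S → Graph n
distanceGraph n S 0∉S = record
  { Adj    = λ i j → does (∣ toℕ i - toℕ j ∣ ∈? S)
  ; sym    = λ i j → cong (λ d → does (d ∈? S)) (∣-∣-comm (toℕ i) (toℕ j))
  ; irrefl = λ i → dec-false (∣ toℕ i - toℕ i ∣ ∈? S) (0∉S ∘ subst (_∈ S) (∣n-n∣≡0 (toℕ i)))
  }

-- Each connection set is closed under d ↦ N − d, so these are the circulant graphs
-- C₂(∅), C₅(1), C₈(2,3) and C₁₃(2,3,4,6).
admissible₁ : Admissible 1 2
admissible₁ = admissible (distanceGraph 2 [] (λ ())) _ _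

admissible₂ : Admissible 2 5
admissible₂ = admissible (distanceGraph 5 S (from-no (0 ∈? S))) _ _
  where S = 1 ∷ 4 ∷ []

admissible₃ : Admissible 3 8
admissible₃ = admissible (distanceGraph 8 S (from-no (0 ∈? S))) _ _
  where S = 2 ∷ 3 ∷ 5 ∷ 6 ∷ []

admissible₄ : Admissible 4 13
admissible₄ = admissible (distanceGraph 13 S (from-no (0 ∈? S))) _ _
  where S = 2 ∷ 3 ∷ 4 ∷ 6 ∷ 7 ∷ 9 ∷ 10 ∷ 11 ∷ []

proposition4p4 : η≡ 1 2 × η≡ 2 5 × η≡ 3 8 × η≡ 4 13 × η≤ 5 18
proposition4p4 =
  (admissible₁ , sizeBound⇒η≤ SizeBounds.sizeBound₁) ,
  (admissible₂ , sizeBound⇒η≤ SizeBounds.sizeBound₂) ,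
  (admissible₃ , sizeBound⇒η≤ SizeBounds.sizeBound₃) ,
  (admissible₄ , sizeBound⇒η≤ SizeBounds.sizeBound₄) ,
  sizeBound⇒η≤ SizeBounds.sizeBound₅
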